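{- Let $n\ge2$, $c$ a Coxeter element of $\widehat{\mathfrak S}_n$ and $i,j\in\{0,\dots,n-1\}$ with $i<j$. Then $\omega_c(\beta_{(i,j)_0},\beta_{(j,i)_1})=2\big(\delta_{i\in\overline{R_c}}-\delta_{j\in\overline{R_c}}\big)$.
   Context: $\widehat{\mathfrak S}_n$: bijections $w$ of $\mathbb Z$ with $w(k+n)=w(k)+n$, $\sum_{k=1}^nw(k)=\sum_{k=1}^nk$, with simple generators $s_i$ ($0\le i\le n-1$) exchanging $i+mn$ and $i+1+mn$ for all $m$. A Coxeter element $c$ is a product of all $s_i$ once each; $\overline{L_c}=\{x\in\mathbb Z:c(x)>x\}$, $\overline{R_c}=\{x:c(x)<x\}$. $(a,b)_p$ is the affine transposition exchanging $a+mn$ and $b+pn+mn$ for all $m$. $V$ has basis $\alpha_0,\dots,\alpha_{n-1}$, $\delta=\sum_i\alpha_i$; for $0\le a<b\le n-1$, $\beta_{(a,b)_0}=\alpha_a+\dots+\alpha_{b-1}$ and $\beta_{(b,a)_1}=\delta-(\alpha_a+\dots+\alpha_{b-1})$ (the positive roots of these reflections). $\omega_c$ is the skew-symmetric bilinear form with $\omega_c(\alpha_a,\alpha_b)=\pm1$ when $b-a\equiv\pm1\pmod n$, sign $+$ iff $s_a$ precedes $s_b$ in a reduced word of $c$, and $0$ otherwise. $\delta_P\in\{0,1\}$ is the indicator of $P$. -}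

module Defs where

open import Data.Nat as ℕ using (ℕ; zero; suc)
open import Data.Integer as ℤ using (ℤ; +_; _<?_)
open import Data.Integer.DivMod using (_%ℕ_)
open import Data.Fin using (Fin; toℕ)
open import Data.Fin.Properties using () renaming (_≟_ to _≟ᶠ_)
open import Data.Bool using (Bool; true; false; if_then_else_)
open import Data.List using (List; []; _∷_)
open import Relation.Nullary using (does)

-- residue of an integer modulo n (n = 0 is a dummy case, never used)
modN : ℕ → ℤ → ℕ
modN zero    x = 0
modN (suc k) x = x %ℕ suc k

nextRes : (n : ℕ) → Fin n → ℕ
nextRes n i = if does (suc (toℕ i) ℕ.≟ n) then 0 else suc (toℕ i)

-- simple generator s_i of the affine symmetric group, as a map ℤ → ℤ:
-- it exchanges i + m n and i + 1 + m n for all m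
sGen : (n : ℕ) → Fin n → ℤ → ℤ
sGen n i x =
  if does (modN n x ℕ.≟ toℕ i) then x ℤ.+ ℤ.1ℤ
  else if does (modN n x ℕ.≟ nextRes n i) then x ℤ.- ℤ.1ℤ
  else x

-- the product s_{a₁} s_{a₂} ⋯ s_{a_k} of a word, as a map ℤ → ℤ
-- (composition of functions: the rightmost letter acts first)
wordPerm : (n : ℕ) → List (Fin n) → ℤ → ℤ
wordPerm n []       x = x
wordPerm n (a ∷ ws) x = sGen n a (wordPerm n ws x)

precedes : {n : ℕ} → Fin n → Fin n → List (Fin n) → Bool
precedes a b []       = false
precedes a b (x ∷ ws) =
  if does (x ≟ᶠ a) then true
  else if does (x ≟ᶠ b) then false
  else precedes a b ws

-- number of edges between a and b in the cyclic Dynkin diagram of type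
-- affine A_{n-1}: [b ≡ a+1 mod n] + [a ≡ b+1 mod n]
-- (for n ≥ 3 this is 1 if b - a ≡ ±1 mod n and 0 otherwise; for n = 2 it is 2)
adjCount : (n : ℕ) → Fin n → Fin n → ℤ
adjCount n a b =
  (if does (toℕ b ℕ.≟ nextRes n a) then ℤ.1ℤ else ℤ.0ℤ)
  ℤ.+ (if does (toℕ a ℕ.≟ nextRes n b) then ℤ.1ℤ else ℤ.0ℤ)

-- ω_c(α_a, α_b) for c given by the reduced word ws
omegaSimple : (n : ℕ) → List (Fin n) → Fin n → Fin n → ℤ
omegaSimple n ws a b =
  if precedes a b ws then adjCount n a b else ℤ.- adjCount n a b

-- vectors of V in the basis α_0,…,α_{n-1}
V : ℕ → Set
V n = Fin n → ℤ

sumFin : (n : ℕ) → (Fin n → ℤ) → ℤ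
sumFin zero    f = ℤ.0ℤ
sumFin (suc n) f = f Fin.zero ℤ.+ sumFin n (λ k → f (Fin.suc k))
  where import Data.Fin as Fin

omega : (n : ℕ) → List (Fin n) → V n → V n → ℤ
omega n ws u v =
  sumFin n (λ a → sumFin n (λ b → u a ℤ.* v b ℤ.* omegaSimple n ws a b))

-- β_{(a,b)_0} = α_a + ⋯ + α_{b-1}   (for a < b)
beta0 : (n : ℕ) → Fin n → Fin n → V n
beta0 n a b k =
  if does (toℕ a ℕ.≤? toℕ k) then (if does (toℕ k ℕ.<? toℕ b) then ℤ.1ℤ else ℤ.0ℤ)
  else ℤ.0ℤ

deltaV : (n : ℕ) → V n
deltaV n k = ℤ.1ℤ

-- β_{(b,a)_1} = δ - (α_a + ⋯ + α_{b-1})   (for a < b)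
beta1 : (n : ℕ) → Fin n → Fin n → V n
beta1 n b a k = deltaV n k ℤ.- beta0 n a b k

-- indicator δ_{x ∈ R̄_c}, where R̄_c = {x ∈ ℤ : c(x) < x}
indR : (ℤ → ℤ) → ℤ → ℤ
indR c x = if does (c x <? x) then ℤ.1ℤ else ℤ.0ℤ

finℤ : {n : ℕ} → Fin n → ℤ
finℤ i = + toℕ i

-- Expanding ω_c bilinearly, only the pairs (a, a ± 1) of adjacent simple roots contribute, with
-- sign + iff s_a precedes s_{a±1} in c.  For β_{(i,j)_0} = α_i + ⋯ + α_{j-1} and
-- β_{(j,i)_1} = δ − β_{(i,j)_0}, the only pairs with a inside [i, j) and a ± 1 outside are the two
-- boundary pairs (j-1, j) and (i, i-1), so the left-hand side is
-- sgn(s_{j-1} before s_j) + sgn(s_i before s_{i-1}).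
-- On the other side, c(x) < x iff s_x precedes s_{x-1} in c: following the point x through the
-- letters of c from right to left, it is fixed until the first of s_{x-1}, s_x acts; that letter
-- moves it to x - 1 or x + 1, and it never crosses back, since that would need the letter just used.
-- As s_{j-1} precedes s_j iff s_j does not precede s_{j-1}, the two sides agree.
module Submission where

open import Defs
open import Data.Bool using (Bool; true; false; not; if_then_else_)
open import Data.Bool.Properties using (if-cong; if-cong-then; if-eta)
open import Data.Fin as Fin using (Fin; zero; suc; toℕ; _<_; fromℕ; fromℕ<; inject₁; _≟_)
import Data.Fin.Properties as Fin
open import Data.Integer as ℤ using (ℤ; +_; _+_; _-_; _*_; -_; 0ℤ; 1ℤ; -1ℤ)
open import Data.Integer.DivMod using (_%ℕ_; _/ℕ_; n%ℕd<d; a≡a%ℕn+[a/ℕn]*n)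
import Data.Integer.Properties as ℤ
open import Data.Integer.Tactic.RingSolver using (solve-∀)
open import Data.List using (List; []; _∷_; allFin)
open import Data.List.Membership.Propositional using (_∈_; _∉_)
open import Data.List.Membership.Propositional.Properties using (∈-allFin)
open import Data.List.Relation.Binary.Permutation.Propositional using (_↭_; ↭-sym; ↭⇒↭ₛ)
open import Data.List.Relation.Binary.Permutation.Propositional.Properties using (∈-resp-↭)
import Data.List.Relation.Binary.Permutation.Setoid.Properties as Permutationₛ
open import Data.List.Relation.Unary.All.Properties using (All¬⇒¬Any)
open import Data.List.Relation.Unary.AllPairs using (_∷_)
open import Data.List.Relation.Unary.Any as Any using (here; there)
open import Data.List.Relation.Unary.Unique.Propositional using (Unique)
open import Data.List.Relation.Unary.Unique.Propositional.Properties using (allFin⁺)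
open import Data.Nat as ℕ using (ℕ; zero; suc; _≤_; z≤n; s≤s; 2+)
import Data.Nat.Properties as ℕ
open import Data.Nat.DivMod using (m<n⇒m%n≡m)
open import Data.Product using (_×_; _,_; proj₁; proj₂)
open import Data.Sum using (_⊎_; inj₁; inj₂)
open import Function using (_∘_; mk⇔)
open import Relation.Binary.PropositionalEquality
  using (_≡_; _≢_; refl; sym; trans; cong; cong₂; subst; setoid; module ≡-Reasoning)
open import Relation.Nullary using (yes; no; does; ¬_; contradiction)
open import Relation.Nullary.Decidable using (dec-true; dec-false; does-⇔)

open import Algebra.Properties.CommutativeMonoid.Sum ℤ.+-0-commutativeMonoid
  using (sum; sum-cong-≗; ∑-distrib-+; sum-replicate-zero)
import Algebra.Properties.AbelianGroup ℤ.+-0-abelianGroup as +-Group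

ind : Bool → ℤ
ind b = if b then 1ℤ else 0ℤ

sgn : Bool → ℤ
sgn b = if b then 1ℤ else -1ℤ

δ : {n : ℕ} → Fin n → Fin n → ℤ
δ a b = ind (does (a ≟ b))

if-neg≡sgn* : ∀ p x → (if p then x else - x) ≡ sgn p * x
if-neg≡sgn* true  x = sym (ℤ.*-identityˡ x)
if-neg≡sgn* false x = sym (ℤ.-1*i≡-i x)

sgn[¬q]+sgn[p]≡2*[ind[p]-ind[q]] : ∀ p q → sgn (not q) + sgn p ≡ + 2 * (ind p - ind q)
sgn[¬q]+sgn[p]≡2*[ind[p]-ind[q]] true  true  = refl
sgn[¬q]+sgn[p]≡2*[ind[p]-ind[q]] true  false = refl
sgn[¬q]+sgn[p]≡2*[ind[p]-ind[q]] false true  = refl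
sgn[¬q]+sgn[p]≡2*[ind[p]-ind[q]] false false = refl

sumFin≡sum : ∀ n (f : Fin n → ℤ) → sumFin n f ≡ sum f
sumFin≡sum zero    f = refl
sumFin≡sum (suc n) f = cong (λ s → f zero + s) (sumFin≡sum n (f ∘ suc))

∑-δ : ∀ {n} (c : Fin n) (f : Fin n → ℤ) → sum (λ b → δ b c * f b) ≡ f c
∑-δ {suc n} zero f = begin
  1ℤ * f zero + sum {n} (λ _ → 0ℤ)  ≡⟨ cong₂ _+_ (ℤ.*-identityˡ (f zero)) (sum-replicate-zero n) ⟩
  f zero + 0ℤ                   ≡⟨ ℤ.+-identityʳ (f zero) ⟩
  f zero                        ∎
  where open ≡-Reasoning
∑-δ {suc n} (suc c) f = trans (ℤ.+-identityˡ _) (∑-δ c (f ∘ suc))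

module _ {k : ℕ} where

  toℕ≮k⇒toℕ≡k : {a : Fin (suc k)} → ¬ toℕ a ℕ.< k → toℕ a ≡ k
  toℕ≮k⇒toℕ≡k {a} a≮k = ℕ.≤-antisym (Fin.toℕ≤pred[n] a) (ℕ.≮⇒≥ a≮k)

  nextRes-last : {a : Fin (suc k)} → toℕ a ≡ k → nextRes (suc k) a ≡ 0
  nextRes-last {a} a≡k =
    if-cong (dec-true (suc (toℕ a) ℕ.≟ suc k) (cong suc a≡k))

  nextRes-< : {a : Fin (suc k)} → toℕ a ℕ.< k → nextRes (suc k) a ≡ suc (toℕ a)
  nextRes-< {a} a<k =
    if-cong (dec-false (suc (toℕ a) ℕ.≟ suc k) (ℕ.<⇒≢ a<k ∘ ℕ.suc-injective))

  nextRes<n : (a : Fin (suc k)) → nextRes (suc k) a ℕ.< suc k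
  nextRes<n a with toℕ a ℕ.<? k
  ... | yes a<k rewrite nextRes-< a<k = ℕ.s≤s a<k
  ... | no  a≮k rewrite nextRes-last (toℕ≮k⇒toℕ≡k a≮k) = ℕ.z<s

  next : Fin (suc k) → Fin (suc k)
  next a = fromℕ< (nextRes<n a)

  prev : Fin (suc k) → Fin (suc k)
  prev zero    = fromℕ k
  prev (suc a) = inject₁ a

  toℕ-next : (a : Fin (suc k)) → toℕ (next a) ≡ nextRes (suc k) a
  toℕ-next a = Fin.toℕ-fromℕ< (nextRes<n a)

  suc[toℕ[prev]] : (a : Fin (suc k)) → 0 ℕ.< toℕ a → suc (toℕ (prev a)) ≡ toℕ a
  suc[toℕ[prev]] (suc a) _ = cong suc (Fin.toℕ-inject₁ a)

  nextRes[prev] : (a : Fin (suc k)) → nextRes (suc k) (prev a) ≡ toℕ a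
  nextRes[prev] zero    = nextRes-last (Fin.toℕ-fromℕ k)
  nextRes[prev] (suc a) =
    trans (nextRes-< (subst (ℕ._< k) (sym (Fin.toℕ-inject₁ a)) (Fin.toℕ<n a))) (cong suc (Fin.toℕ-inject₁ a))

  next-prev : (a : Fin (suc k)) → next (prev a) ≡ a
  next-prev a = Fin.toℕ-injective (trans (toℕ-next (prev a)) (nextRes[prev] a))

  toℕ≡nextRes⇒prev≡ : {a b : Fin (suc k)} → toℕ b ≡ nextRes (suc k) a → prev b ≡ a
  toℕ≡nextRes⇒prev≡ {a} {b} b≡next with toℕ a ℕ.<? k
  ... | yes a<k = Fin.toℕ-injective (ℕ.suc-injective (trans (suc[toℕ[prev]] b 0<b) b≡sa))
    where
    b≡sa = trans b≡next (nextRes-< a<k)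
    0<b = subst (0 ℕ.<_) (sym b≡sa) ℕ.z<s
  ... | no  a≮k = Fin.toℕ-injective (trans (cong (toℕ ∘ prev) b≡0) (trans (Fin.toℕ-fromℕ k) (sym a≡k)))
    where
    a≡k = toℕ≮k⇒toℕ≡k a≮k
    b≡0 : b ≡ zero
    b≡0 = Fin.toℕ-injective (trans b≡next (nextRes-last a≡k))

  prev-next : (a : Fin (suc k)) → prev (next a) ≡ a
  prev-next a = toℕ≡nextRes⇒prev≡ (toℕ-next a)

  nextRes-injective : {a b : Fin (suc k)} → nextRes (suc k) a ≡ nextRes (suc k) b → a ≡ b
  nextRes-injective {a} {b} eq = trans (sym (toℕ≡nextRes⇒prev≡ (trans (toℕ-next b) (sym eq)))) (prev-next b)

prev≢ : {k : ℕ} (a : Fin (2+ k)) → prev a ≢ a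
prev≢ zero    ()
prev≢ (suc a) eq = ℕ.1+n≢n (sym (trans (sym (Fin.toℕ-inject₁ a)) (cong toℕ eq)))

-- ω_c on simple roots and its bilinear extension

module _ {k : ℕ} (ws : List (Fin (suc k))) where

  omegaSimple-neighbours : (a b : Fin (suc k)) →
    omegaSimple (suc k) ws a b ≡ sgn (precedes a b ws) * (δ b (next a) + δ b (prev a))
  omegaSimple-neighbours a b = begin
    omegaSimple (suc k) ws a b
      ≡⟨ if-neg≡sgn* (precedes a b ws) (adjCount (suc k) a b) ⟩
    sgn (precedes a b ws) * adjCount (suc k) a b
      ≡⟨ cong (λ x → sgn (precedes a b ws) * x) (cong₂ _+_ (cong ind b≡next) (cong ind b≡prev)) ⟩
    sgn (precedes a b ws) * (δ b (next a) + δ b (prev a)) ∎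
    where
    open ≡-Reasoning
    b≡next = does-⇔ (mk⇔ (λ e → Fin.toℕ-injective (trans e (sym (toℕ-next a))))
                          (λ e → trans (cong toℕ e) (toℕ-next a)))
                    (toℕ b ℕ.≟ nextRes (suc k) a) (b ≟ next a)
    b≡prev = does-⇔ (mk⇔ (sym ∘ toℕ≡nextRes⇒prev≡)
                          (λ e → trans (sym (nextRes[prev] a)) (cong (nextRes (suc k)) (sym e))))
                    (toℕ a ℕ.≟ nextRes (suc k) b) (b ≟ prev a)

  omega≡∑neighbours : (u v : V (suc k)) →
    omega (suc k) ws u v
      ≡ sum (λ a → u a * v (next a) * sgn (precedes a (next a) ws))
        + sum (λ a → u a * v (prev a) * sgn (precedes a (prev a) ws))
  omega≡∑neighbours u v = begin
    omega (suc k) ws u v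
      ≡⟨ sumFin≡sum (suc k) (λ a → sumFin (suc k) (term a)) ⟩
    sum (λ a → sumFin (suc k) (term a))
      ≡⟨ sum-cong-≗ (λ a → trans (sumFin≡sum (suc k) (term a)) (inner a)) ⟩
    sum (λ a → edge a (next a) + edge a (prev a))
      ≡⟨ ∑-distrib-+ (λ a → edge a (next a)) (λ a → edge a (prev a)) ⟩
    sum (λ a → edge a (next a)) + sum (λ a → edge a (prev a)) ∎
    where
    open ≡-Reasoning
    term : Fin (suc k) → Fin (suc k) → ℤ
    term a b = u a * v b * omegaSimple (suc k) ws a b
    edge : Fin (suc k) → Fin (suc k) → ℤ
    edge a b = u a * v b * sgn (precedes a b ws)
    split : ∀ x s d₁ d₂ → x * (s * (d₁ + d₂)) ≡ d₁ * (x * s) + d₂ * (x * s)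
    split = solve-∀
    inner : ∀ a → sum (term a) ≡ edge a (next a) + edge a (prev a)
    inner a = begin
      sum (term a)
        ≡⟨ sum-cong-≗ (λ b → trans (cong (u a * v b *_) (omegaSimple-neighbours a b))
                                    (split (u a * v b) (sgn (precedes a b ws)) (δ b (next a)) (δ b (prev a)))) ⟩
      sum (λ b → δ b (next a) * edge a b + δ b (prev a) * edge a b)
        ≡⟨ ∑-distrib-+ (λ b → δ b (next a) * edge a b) (λ b → δ b (prev a) * edge a b) ⟩
      sum (λ b → δ b (next a) * edge a b) + sum (λ b → δ b (prev a) * edge a b)
        ≡⟨ cong₂ _+_ (∑-δ (next a) (edge a)) (∑-δ (prev a) (edge a)) ⟩
      edge a (next a) + edge a (prev a) ∎

-- The interval [i, j) and its two boundary pairs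

module _ {n : ℕ} (i j : Fin n) where

  beta0-inside : {a : Fin n} → toℕ i ℕ.≤ toℕ a → toℕ a ℕ.< toℕ j → beta0 n i j a ≡ 1ℤ
  beta0-inside {a} i≤a a<j =
    trans (if-cong (dec-true (toℕ i ℕ.≤? toℕ a) i≤a)) (if-cong (dec-true (toℕ a ℕ.<? toℕ j) a<j))

  beta0-below : {a : Fin n} → toℕ a ℕ.< toℕ i → beta0 n i j a ≡ 0ℤ
  beta0-below {a} a<i = if-cong (dec-false (toℕ i ℕ.≤? toℕ a) (ℕ.<⇒≱ a<i))

  beta0-above : {a : Fin n} → toℕ j ℕ.≤ toℕ a → beta0 n i j a ≡ 0ℤ
  beta0-above {a} j≤a =
    trans (if-cong-then (does (toℕ i ℕ.≤? toℕ a)) a<j≡false) (if-eta (does (toℕ i ℕ.≤? toℕ a)))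
    where
    a<j≡false = if-cong (dec-false (toℕ a ℕ.<? toℕ j) (ℕ.≤⇒≯ j≤a))

  beta0-outside-or-inside : (a : Fin n) → beta0 n i j a ≡ 0ℤ ⊎ (toℕ i ℕ.≤ toℕ a × toℕ a ℕ.< toℕ j)
  beta0-outside-or-inside a with toℕ a ℕ.<? toℕ i | toℕ a ℕ.<? toℕ j
  ... | yes a<i | _       = inj₁ (beta0-below a<i)
  ... | no  _   | no  a≮j = inj₁ (beta0-above (ℕ.≮⇒≥ a≮j))
  ... | no  a≮i | yes a<j = inj₂ (ℕ.≮⇒≥ a≮i , a<j)

module _ {k : ℕ} {i j : Fin (suc k)} (i<j : i < j) where

  private
    β : Fin (suc k) → ℤ
    β = beta0 (suc k) i j

  right-boundary : (a : Fin (suc k)) → β a * (1ℤ - β (next a)) ≡ δ a (prev j)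
  -- Matching on a ≟ prev j also evaluates the δ a (prev j) on the right.
  right-boundary a with a ≟ prev j
  ... | yes refl = cong₂ (λ x y → x * (1ℤ - y)) β[prev-j] β[next-prev-j]
    where
    1+prev≡ = suc[toℕ[prev]] j (ℕ.≤-<-trans z≤n i<j)
    β[prev-j] = beta0-inside i j (ℕ.s≤s⁻¹ (subst (ℕ._≤_ _) (sym 1+prev≡) i<j)) (ℕ.≤-reflexive 1+prev≡)
    β[next-prev-j] = trans (cong β (next-prev j)) (beta0-above i j ℕ.≤-refl)
  ... | no a≢pj with beta0-outside-or-inside i j a
  ...   | inj₁ β≡0        = cong (_* (1ℤ - β (next a))) β≡0
  ...   | inj₂ (i≤a , a<j) = cong₂ (λ x y → x * (1ℤ - y)) (beta0-inside i j i≤a a<j) β[next-a]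
    where
    a<k = ℕ.<-≤-trans a<j (Fin.toℕ≤pred[n] j)
    next≡suc = trans (toℕ-next a) (nextRes-< a<k)
    suc≢j : suc (toℕ a) ≢ toℕ j
    suc≢j sa≡j = a≢pj (sym (toℕ≡nextRes⇒prev≡ (trans (sym sa≡j) (sym (nextRes-< a<k)))))
    β[next-a] = beta0-inside i j (subst (toℕ i ℕ.≤_) (sym next≡suc) (ℕ.m≤n⇒m≤1+n i≤a))
                             (subst (ℕ._< toℕ j) (sym next≡suc) (ℕ.≤∧≢⇒< a<j suc≢j))

  left-boundary : (a : Fin (suc k)) → β a * (1ℤ - β (prev a)) ≡ δ a i
  left-boundary a with a ≟ i
  ... | yes refl = cong₂ (λ x y → x * (1ℤ - y)) (beta0-inside i j ℕ.≤-refl i<j) (β[prev-i] a)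
    where
    β[prev-i] : (c : Fin (suc k)) → beta0 (suc k) c j (prev c) ≡ 0ℤ
    β[prev-i] zero    = beta0-above zero j (subst (toℕ j ℕ.≤_) (sym (Fin.toℕ-fromℕ k)) (Fin.toℕ≤pred[n] j))
    β[prev-i] (suc c) = beta0-below (suc c) j (ℕ.s≤s (ℕ.≤-reflexive (Fin.toℕ-inject₁ c)))
  ... | no a≢i with beta0-outside-or-inside i j a
  ...   | inj₁ β≡0        = cong (_* (1ℤ - β (prev a))) β≡0
  ...   | inj₂ (i≤a , a<j) = cong₂ (λ x y → x * (1ℤ - y)) (beta0-inside i j i≤a a<j) β[prev-a]
    where
    i<a = ℕ.≤∧≢⇒< i≤a (λ e → a≢i (sym (Fin.toℕ-injective e)))
    1+prev≡ = suc[toℕ[prev]] a (ℕ.≤-<-trans z≤n i<a)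
    β[prev-a] = beta0-inside i j (ℕ.s≤s⁻¹ (subst (ℕ._≤_ _) (sym 1+prev≡) i<a))
                                 (ℕ.<-trans (ℕ.≤-reflexive 1+prev≡) a<j)

  omega-interval : (ws : List (Fin (suc k))) →
    omega (suc k) ws (beta0 (suc k) i j) (beta1 (suc k) j i)
      ≡ sgn (precedes (prev j) j ws) + sgn (precedes i (prev i) ws)
  omega-interval ws = begin
    omega (suc k) ws β (beta1 (suc k) j i)
      ≡⟨ omega≡∑neighbours ws β (beta1 (suc k) j i) ⟩
    sum (λ a → β a * (1ℤ - β (next a)) * sgn (precedes a (next a) ws))
      + sum (λ a → β a * (1ℤ - β (prev a)) * sgn (precedes a (prev a) ws))
      ≡⟨ cong₂ _+_ (sum-cong-≗ (λ a → cong (_* sgn (precedes a (next a) ws)) (right-boundary a)))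
                   (sum-cong-≗ (λ a → cong (_* sgn (precedes a (prev a) ws)) (left-boundary a))) ⟩
    sum (λ a → δ a (prev j) * sgn (precedes a (next a) ws))
      + sum (λ a → δ a i * sgn (precedes a (prev a) ws))
      ≡⟨ cong₂ _+_ (∑-δ (prev j) (λ a → sgn (precedes a (next a) ws)))
                   (∑-δ i (λ a → sgn (precedes a (prev a) ws))) ⟩
    sgn (precedes (prev j) (next (prev j)) ws) + sgn (precedes i (prev i) ws)
      ≡⟨ cong (λ b → sgn (precedes (prev j) b ws) + _) (next-prev j) ⟩
    sgn (precedes (prev j) j ws) + sgn (precedes i (prev i) ws) ∎
    where open ≡-Reasoning

quotient-≤ : ∀ {d q q′ y} → q * + d ℤ.≤ y → y ℤ.< ℤ.suc q′ * + d → q ℤ.≤ q′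
quotient-≤ {d} {q} {q′} {y} qd≤y y<[1+q′]d with q ℤ.≤? q′
... | yes q≤q′ = q≤q′
... | no  q≰q′ = contradiction (ℤ.≤-<-trans (ℤ.≤-trans [1+q′]d≤qd qd≤y) y<[1+q′]d) (ℤ.<-irrefl refl)
  where [1+q′]d≤qd = ℤ.*-monoʳ-≤-nonNeg (+ d) (ℤ.i<j⇒suc[i]≤j (ℤ.≰⇒> q≰q′))

division-bounds : ∀ {d} q r → r ℕ.< d → q * + d ℤ.≤ + r + q * + d × + r + q * + d ℤ.< ℤ.suc q * + d
division-bounds {d} q r r<d = ℤ.i≤j+i (q * + d) (+ r) , r+qd<[1+q]d
  where
  r+qd<[1+q]d = subst (+ r + q * + d ℤ.<_) (sym (ℤ.suc-* q (+ d))) (ℤ.+-monoˡ-< (q * + d) (ℤ.+<+ r<d))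

%ℕ-unique : ∀ d .{{_ : ℕ.NonZero d}} q r → r ℕ.< d → (+ r + q * + d) %ℕ d ≡ r
%ℕ-unique d q r r<d = sym (ℤ.+-injective (+-Group.∙-cancelʳ (q * + d) (+ r) (+ r′) y≡r′+qd))
  where
  y  = + r + q * + d
  q′ = y /ℕ d
  r′ = y %ℕ d
  y≡ : y ≡ + r′ + q′ * + d
  y≡ = a≡a%ℕn+[a/ℕn]*n y d
  bounds = division-bounds q r r<d
  bounds′ = division-bounds q′ r′ (n%ℕd<d y d)
  q≡q′ : q ≡ q′
  q≡q′ = ℤ.≤-antisym (quotient-≤ (proj₁ bounds) (subst (ℤ._< ℤ.suc q′ * + d) (sym y≡) (proj₂ bounds′)))
                     (quotient-≤ (subst (q′ * + d ℤ.≤_) (sym y≡) (proj₁ bounds′)) (proj₂ bounds))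
  y≡r′+qd : y ≡ + r′ + q * + d
  y≡r′+qd = trans y≡ (cong (λ x → + r′ + x * + d) (sym q≡q′))

residue[1+a+q*n] : ∀ {k} (a : Fin (suc k)) q →
  modN (suc k) (ℤ.suc (+ toℕ a + q * + suc k)) ≡ nextRes (suc k) a
residue[1+a+q*n] {k} a q with toℕ a ℕ.<? k
... | yes a<k = begin
  (ℤ.suc (+ toℕ a + q * + suc k)) %ℕ suc k  ≡⟨ cong (_%ℕ suc k) (ℤ.+-assoc 1ℤ (+ toℕ a) (q * + suc k)) ⟨
  (+ suc (toℕ a) + q * + suc k) %ℕ suc k    ≡⟨ %ℕ-unique (suc k) q (suc (toℕ a)) (ℕ.s≤s a<k) ⟩
  suc (toℕ a)                               ≡⟨ nextRes-< a<k ⟨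
  nextRes (suc k) a                         ∎
  where open ≡-Reasoning
... | no  a≮k = begin
  (ℤ.suc (+ toℕ a + q * + suc k)) %ℕ suc k  ≡⟨ cong (_%ℕ suc k) (ℤ.+-assoc 1ℤ (+ toℕ a) (q * + suc k)) ⟨
  (+ suc (toℕ a) + q * + suc k) %ℕ suc k    ≡⟨ cong (λ m → (+ suc m + q * + suc k) %ℕ suc k) a≡k ⟩
  (+ suc k + q * + suc k) %ℕ suc k          ≡⟨ cong (_%ℕ suc k) (ℤ.suc-* q (+ suc k)) ⟨
  (ℤ.suc q * + suc k) %ℕ suc k              ≡⟨ cong (_%ℕ suc k) (ℤ.+-identityˡ (ℤ.suc q * + suc k)) ⟨
  (+ 0 + ℤ.suc q * + suc k) %ℕ suc k        ≡⟨ %ℕ-unique (suc k) (ℤ.suc q) 0 ℕ.z<s ⟩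
  0                                         ≡⟨ nextRes-last a≡k ⟨
  nextRes (suc k) a                         ∎
  where
  open ≡-Reasoning
  a≡k = toℕ≮k⇒toℕ≡k a≮k

residue-suc : ∀ {k y} {a : Fin (suc k)} → modN (suc k) y ≡ toℕ a →
  modN (suc k) (ℤ.suc y) ≡ nextRes (suc k) a
residue-suc {k} {y} {a} y≡a =
  subst (λ x → modN (suc k) (ℤ.suc x) ≡ nextRes (suc k) a) (sym y≡) (residue[1+a+q*n] a (y /ℕ suc k))
  where
  y≡ : y ≡ + toℕ a + (y /ℕ suc k) * + suc k
  y≡ = trans (a≡a%ℕn+[a/ℕn]*n y (suc k)) (cong (λ r → + r + (y /ℕ suc k) * + suc k) y≡a)

-- How a simple generator moves a point

data Step (n : ℕ) (a : Fin n) (z : ℤ) : ℤ → Set where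
  up   : modN n z ≡ toℕ a → Step n a z (ℤ.suc z)
  down : modN n z ≢ toℕ a → modN n z ≡ nextRes n a → Step n a z (ℤ.pred z)
  stay : modN n z ≢ toℕ a → modN n z ≢ nextRes n a → Step n a z z

step : ∀ {n} (a : Fin n) z → Step n a z (sGen n a z)
step {n} a z with modN n z ℕ.≟ toℕ a
... | yes z≡a = subst (Step n a z) (sym sGen≡) (up z≡a)
  where
  sGen≡ : sGen n a z ≡ ℤ.suc z
  sGen≡ = trans (if-cong (dec-true (modN n z ℕ.≟ toℕ a) z≡a)) (ℤ.+-comm z 1ℤ)
... | no z≢a with modN n z ℕ.≟ nextRes n a
...   | yes z≡next = subst (Step n a z) (sym sGen≡) (down z≢a z≡next)
  where
  sGen≡ : sGen n a z ≡ ℤ.pred z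
  sGen≡ = trans (if-cong (dec-false (modN n z ℕ.≟ toℕ a) z≢a))
                (trans (if-cong (dec-true (modN n z ℕ.≟ nextRes n a) z≡next)) (ℤ.+-comm z -1ℤ))
...   | no z≢next = subst (Step n a z) (sym sGen≡) (stay z≢a z≢next)
  where
  sGen≡ : sGen n a z ≡ z
  sGen≡ = trans (if-cong (dec-false (modN n z ℕ.≟ toℕ a) z≢a))
                (if-cong (dec-false (modN n z ℕ.≟ nextRes n a) z≢next))

module _ {k : ℕ} {r : Fin (2+ k)} {y : ℤ} (y≡r : modN (2+ k) y ≡ toℕ r) where

  sGen-fixes : ∀ {a} → a ≢ r → a ≢ prev r → sGen (2+ k) a y ≡ y
  sGen-fixes {a} a≢r a≢pr with sGen (2+ k) a y | step a y
  ... | _ | up y≡a         = contradiction (Fin.toℕ-injective (trans (sym y≡a) y≡r)) a≢r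
  ... | _ | down _ y≡next  = contradiction (sym (toℕ≡nextRes⇒prev≡ (trans (sym y≡r) y≡next))) a≢pr
  ... | _ | stay _ _       = refl

  sGen-lowers : sGen (2+ k) (prev r) y ℤ.< y
  sGen-lowers with sGen (2+ k) (prev r) y | step (prev r) y
  ... | _ | up y≡pr        = contradiction (Fin.toℕ-injective (trans (sym y≡pr) y≡r)) (prev≢ r)
  ... | _ | down _ _       = ℤ.i≤pred[j]⇒i<j ℤ.≤-refl
  ... | _ | stay _ y≢next  = contradiction (trans y≡r (sym (nextRes[prev] r))) y≢next

  sGen-raises : y ℤ.< sGen (2+ k) r y
  sGen-raises with sGen (2+ k) r y | step r y
  ... | _ | up _           = ℤ.suc[i]≤j⇒i<j ℤ.≤-refl
  ... | _ | down y≢r _     = contradiction y≡r y≢r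
  ... | _ | stay y≢r _     = contradiction y≡r y≢r

  -- Climbing from y - 1 back to y would need the letter prev r.
  sGen-stays-below : ∀ {a z} → a ≢ prev r → z ℤ.< y → sGen (2+ k) a z ℤ.< y
  sGen-stays-below {a} {z} a≢pr z<y with sGen (2+ k) a z | step a z
  ... | _ | stay _ _ = z<y
  ... | _ | down _ _ = ℤ.≤-<-trans (ℤ.i≤j⇒pred[i]≤j ℤ.≤-refl) z<y
  ... | _ | up z≡a with ℤ.suc z ℤ.≟ y
  ...   | yes 1+z≡y = contradiction (sym (toℕ≡nextRes⇒prev≡ (trans (sym y≡r) y≡next))) a≢pr
    where
    y≡next = subst (λ x → modN (2+ k) x ≡ nextRes (2+ k) a) 1+z≡y (residue-suc {y = z} z≡a)
  ...   | no  1+z≢y = ℤ.≤∧≢⇒< (ℤ.i<j⇒suc[i]≤j z<y) 1+z≢y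

  -- Descending from y + 1 back to y would need the letter r.
  sGen-stays-above : ∀ {a z} → a ≢ r → y ℤ.< z → y ℤ.< sGen (2+ k) a z
  sGen-stays-above {a} {z} a≢r y<z with sGen (2+ k) a z | step a z
  ... | _ | stay _ _ = y<z
  ... | _ | up _     = ℤ.<-≤-trans y<z (ℤ.i≤suc[i] z)
  ... | _ | down _ z≡next with ℤ.suc y ℤ.≟ z
  ...   | yes 1+y≡z = contradiction (nextRes-injective (trans (sym z≡next) z≡next-r)) a≢r
    where
    z≡next-r = subst (λ x → modN (2+ k) x ≡ nextRes (2+ k) r) 1+y≡z (residue-suc {y = y} y≡r)
  ...   | no  1+y≢z = ℤ.suc[i]≤j⇒i<j (ℤ.i<j⇒i≤pred[j] 1+y<z)
    where 1+y<z = ℤ.≤∧≢⇒< (ℤ.i<j⇒suc[i]≤j y<z) 1+y≢z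

module _ {n : ℕ} where

  data Letter (r p : Fin n) : Fin n → Set where
    first  : Letter r p r
    second : Letter r p p
    other  : ∀ {a} → a ≢ r → a ≢ p → Letter r p a

  letter : (r p a : Fin n) → Letter r p a
  letter r p a with a ≟ r | a ≟ p
  ... | yes refl | _        = first
  ... | no  _    | yes refl = second
  ... | no  a≢r  | no  a≢p  = other a≢r a≢p

  precedes-head-first : (a b : Fin n) (vs : List (Fin n)) → precedes a b (a ∷ vs) ≡ true
  precedes-head-first a b vs = if-cong (dec-true (a ≟ a) refl)

  precedes-head-second : {a b : Fin n} (vs : List (Fin n)) → b ≢ a → precedes a b (b ∷ vs) ≡ false
  precedes-head-second {a} {b} vs b≢a =
    trans (if-cong (dec-false (b ≟ a) b≢a)) (if-cong (dec-true (b ≟ b) refl))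

  precedes-head-other : {a b c : Fin n} (vs : List (Fin n)) → c ≢ a → c ≢ b →
    precedes a b (c ∷ vs) ≡ precedes a b vs
  precedes-head-other {a} {b} {c} vs c≢a c≢b =
    trans (if-cong (dec-false (c ≟ a) c≢a)) (if-cong (dec-false (c ≟ b) c≢b))

  precedes-flip : {a b : Fin n} (vs : List (Fin n)) → a ≢ b → a ∈ vs →
    precedes b a vs ≡ not (precedes a b vs)
  precedes-flip {a} {b} (c ∷ vs) a≢b a∈ with letter a b c
  ... | first         = trans (precedes-head-second vs a≢b) (cong not (sym (precedes-head-first a b vs)))
  ... | second        = trans (precedes-head-first b a vs) (cong not (sym (precedes-head-second vs (a≢b ∘ sym))))
  ... | other c≢a c≢b = begin
    precedes b a (c ∷ vs)        ≡⟨ precedes-head-other vs c≢b c≢a ⟩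
    precedes b a vs              ≡⟨ precedes-flip vs a≢b (Any.tail (c≢a ∘ sym) a∈) ⟩
    not (precedes a b vs)        ≡⟨ cong not (precedes-head-other vs c≢a c≢b) ⟨
    not (precedes a b (c ∷ vs))  ∎
    where open ≡-Reasoning

-- How a word without repeated letters moves a point

module _ {k : ℕ} {r : Fin (2+ k)} {y : ℤ} (y≡r : modN (2+ k) y ≡ toℕ r) where

  wordPerm-fixes : (vs : List (Fin (2+ k))) → r ∉ vs → prev r ∉ vs → wordPerm (2+ k) vs y ≡ y
  wordPerm-fixes []       _  _   = refl
  wordPerm-fixes (a ∷ vs) r∉ pr∉ =
    trans (cong (sGen (2+ k) a) (wordPerm-fixes vs (r∉ ∘ there) (pr∉ ∘ there)))
          (sGen-fixes y≡r (λ a≡r → r∉ (here (sym a≡r))) (λ a≡pr → pr∉ (here (sym a≡pr))))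

  wordPerm-lowers : (vs : List (Fin (2+ k))) → Unique vs → prev r ∈ vs →
    (r ∈ vs → precedes r (prev r) vs ≡ true) → wordPerm (2+ k) vs y ℤ.< y
  wordPerm-lowers (a ∷ vs) (a∉vs ∷ uniq) pr∈ r-first with letter r (prev r) a
  ... | first = sGen-stays-below y≡r (prev≢ r ∘ sym) (wordPerm-lowers vs uniq pr∈vs r∉vs)
    where
    pr∈vs = Any.tail (prev≢ r) pr∈
    r∉vs : r ∈ vs → precedes r (prev r) vs ≡ true
    r∉vs r∈vs = contradiction r∈vs (All¬⇒¬Any a∉vs)
  ... | second = subst (λ z → sGen (2+ k) (prev r) z ℤ.< y) (sym fixed) (sGen-lowers y≡r)
    where
    r∉ : r ∉ prev r ∷ vs
    r∉ r∈ = contradiction (trans (sym (r-first r∈)) (precedes-head-second vs (prev≢ r))) λ ()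
    fixed = wordPerm-fixes vs (r∉ ∘ there) (All¬⇒¬Any a∉vs)
  ... | other a≢r a≢pr = sGen-stays-below y≡r a≢pr (wordPerm-lowers vs uniq pr∈vs r-first′)
    where
    pr∈vs = Any.tail (a≢pr ∘ sym) pr∈
    r-first′ : r ∈ vs → precedes r (prev r) vs ≡ true
    r-first′ = trans (sym (precedes-head-other vs a≢r a≢pr)) ∘ r-first ∘ there

  wordPerm-raises : (vs : List (Fin (2+ k))) → Unique vs → r ∈ vs →
    (prev r ∈ vs → precedes r (prev r) vs ≡ false) → y ℤ.< wordPerm (2+ k) vs y
  wordPerm-raises (a ∷ vs) (a∉vs ∷ uniq) r∈ pr-later with letter r (prev r) a
  ... | first = subst (λ z → y ℤ.< sGen (2+ k) r z) (sym fixed) (sGen-raises y≡r)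
    where
    pr∉ : prev r ∉ r ∷ vs
    pr∉ pr∈ = contradiction (trans (sym (pr-later pr∈)) (precedes-head-first r (prev r) vs)) λ ()
    fixed = wordPerm-fixes vs (All¬⇒¬Any a∉vs) (pr∉ ∘ there)
  ... | second = sGen-stays-above y≡r (prev≢ r) (wordPerm-raises vs uniq r∈vs pr∉vs)
    where
    r∈vs = Any.tail (prev≢ r ∘ sym) r∈
    pr∉vs : prev r ∈ vs → precedes r (prev r) vs ≡ false
    pr∉vs pr∈vs = contradiction pr∈vs (All¬⇒¬Any a∉vs)
  ... | other a≢r a≢pr = sGen-stays-above y≡r a≢r (wordPerm-raises vs uniq r∈vs pr-later′)
    where
    r∈vs = Any.tail (a≢r ∘ sym) r∈
    pr-later′ : prev r ∈ vs → precedes r (prev r) vs ≡ false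
    pr-later′ = trans (sym (precedes-head-other vs a≢r a≢pr)) ∘ pr-later ∘ there

finℤ-residue : ∀ {k} (r : Fin (suc k)) → modN (suc k) (finℤ r) ≡ toℕ r
finℤ-residue r = m<n⇒m%n≡m (Fin.toℕ<n r)

indR-wordPerm : ∀ {k} {ws : List (Fin (2+ k))} {r} → Unique ws → r ∈ ws → prev r ∈ ws →
  indR (wordPerm (2+ k) ws) (finℤ r) ≡ ind (precedes r (prev r) ws)
indR-wordPerm {k} {ws} {r} uniq r∈ pr∈ with precedes r (prev r) ws in r-first
... | true  = if-cong (dec-true (wordPerm (2+ k) ws (finℤ r) ℤ.<? finℤ r)
                        (wordPerm-lowers (finℤ-residue r) ws uniq pr∈ (λ _ → r-first)))
... | false = if-cong (dec-false (wordPerm (2+ k) ws (finℤ r) ℤ.<? finℤ r)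
                        (ℤ.<-asym (wordPerm-raises (finℤ-residue r) ws uniq r∈ (λ _ → r-first))))

proposition2p11 : (n : ℕ) → 2 ≤ n → (ws : List (Fin n)) → ws ↭ allFin n →
    (i j : Fin n) → i < j →
    omega n ws (beta0 n i j) (beta1 n j i)
      ≡ + 2 * (indR (wordPerm n ws) (finℤ i) - indR (wordPerm n ws) (finℤ j))
proposition2p11 (2+ k) (s≤s (s≤s z≤n)) ws ws↭allFin i j i<j = begin
  omega (2+ k) ws (beta0 (2+ k) i j) (beta1 (2+ k) j i)
    ≡⟨ omega-interval i<j ws ⟩
  sgn (precedes (prev j) j ws) + sgn p
    ≡⟨ cong (λ b → sgn b + sgn p) (precedes-flip ws (prev≢ j ∘ sym) (∈ws j)) ⟩
  sgn (not q) + sgn p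
    ≡⟨ sgn[¬q]+sgn[p]≡2*[ind[p]-ind[q]] p q ⟩
  + 2 * (ind p - ind q)
    ≡⟨ cong₂ (λ x y → + 2 * (x - y)) (indR-wordPerm uniq (∈ws i) (∈ws (prev i)))
                                      (indR-wordPerm uniq (∈ws j) (∈ws (prev j))) ⟨
  + 2 * (indR (wordPerm (2+ k) ws) (finℤ i) - indR (wordPerm (2+ k) ws) (finℤ j)) ∎
  where
  open ≡-Reasoning
  p = precedes i (prev i) ws
  q = precedes j (prev j) ws
  ∈ws : ∀ a → a ∈ ws
  ∈ws a = ∈-resp-↭ (↭-sym ws↭allFin) (∈-allFin a)
  uniq : Unique ws
  uniq = Permutationₛ.Unique-resp-↭ (setoid (Fin (2+ k))) (↭⇒↭ₛ (↭-sym ws↭allFin)) (allFin⁺ (2+ k))
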